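{- For any connected graphs $G$ and $H$, $$\beta(G_{SR}\boxtimes H_{SR})\ge \beta((G\boxtimes H)_{SR})\ge \beta(G_{SR}\oplus H_{SR}).$$
   Context: All graphs are finite and simple; $\beta(X)$ denotes the independence number of a graph $X$ (largest size of a set of pairwise non-adjacent vertices). A vertex $u$ is maximally distant from $v$ in $G$ if $d_G(v,w)\le d_G(u,v)$ for every neighbour $w$ of $u$ ($d_G$ = shortest-path distance); $u,v$ are mutually maximally distant if each is maximally distant from the other. The strong resolving graph $G_{SR}$ has vertex set $V(G)$, with $u,v$ adjacent iff they are mutually maximally distant in $G$. The strong product $G\boxtimes H$ has vertex set $V(G)\times V(H)$, with $(a,b)\sim(c,d)$ iff ($a=c$ and $bd\in E(H)$) or ($ac\in E(G)$ and $b=d$) or ($ac\in E(G)$ and $bd\in E(H)$). The Cartesian sum $G\oplus H$ has vertex set $V(G)\times V(H)$, with $(a,b)\sim(c,d)$ iff $ac\in E(G)$ or $bd\in E(H)$. -}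

module Defs where

open import Data.Nat using (ℕ; zero; suc; _≤_)
open import Data.Fin using (Fin)
open import Data.Product using (_×_; _,_; ∃; Σ)
open import Data.Sum using (_⊎_)
open import Data.List using (List; length)
open import Data.List.Membership.Propositional using (_∈_)
open import Data.List.Relation.Unary.Unique.Propositional using (Unique)
open import Relation.Nullary using (¬_)
open import Relation.Binary.PropositionalEquality using (_≡_)
open import Level using (0ℓ)

record Graph (V : Set) : Set₁ where
  field
    Adj   : V → V → Set
    sym   : ∀ {u v} → Adj u v → Adj v u
    irrefl : ∀ {u} → ¬ Adj u u
open Graph public

FinGraph : ℕ → Set₁
FinGraph n = Graph (Fin n)

data Walk {V : Set} (G : Graph V) : V → V → ℕ → Set where
  here : ∀ {u} → Walk G u u zero
  step : ∀ {u w v k} → Adj G u w → Walk G w v k → Walk G u v (suc k)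

Dist : {V : Set} → Graph V → V → V → ℕ → Set
Dist G u v k = Walk G u v k × (∀ j → Walk G u v j → k ≤ j)

Connected : {V : Set} → Graph V → Set
Connected {V} G = ∀ (u v : V) → ∃ λ k → Walk G u v k

MaxDist : {V : Set} → Graph V → V → V → Set
MaxDist G u v = ∀ w → Adj G u w → ∀ a b → Dist G v w a → Dist G u v b → a ≤ b

MMD : {V : Set} → Graph V → V → V → Set
MMD G u v = MaxDist G u v × MaxDist G v u

SR : {V : Set} → Graph V → Graph V
SR G = record
  { Adj = λ u v → ¬ (u ≡ v) × MMD G u v
  ; sym = λ { (ne , a , b) → (λ e → ne (Relation.Binary.PropositionalEquality.sym e)) , b , a }
  ; irrefl = λ { (ne , _) → ne Relation.Binary.PropositionalEquality.refl }
  }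

_⊠_ : {V W : Set} → Graph V → Graph W → Graph (V × W)
_⊠_ G H = record
  { Adj = λ { (a , b) (c , d) →
        (a ≡ c × Adj H b d) ⊎ (Adj G a c × b ≡ d) ⊎ (Adj G a c × Adj H b d) }
  ; sym = λ { (Data.Sum.inj₁ (e , h)) → Data.Sum.inj₁ (Relation.Binary.PropositionalEquality.sym e , sym H h)
            ; (Data.Sum.inj₂ (Data.Sum.inj₁ (g , e))) → Data.Sum.inj₂ (Data.Sum.inj₁ (sym G g , Relation.Binary.PropositionalEquality.sym e))
            ; (Data.Sum.inj₂ (Data.Sum.inj₂ (g , h))) → Data.Sum.inj₂ (Data.Sum.inj₂ (sym G g , sym H h)) }
  ; irrefl = λ { (Data.Sum.inj₁ (_ , h)) → irrefl H h
               ; (Data.Sum.inj₂ (Data.Sum.inj₁ (g , _))) → irrefl G g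
               ; (Data.Sum.inj₂ (Data.Sum.inj₂ (g , _))) → irrefl G g }
  }

_⊕_ : {V W : Set} → Graph V → Graph W → Graph (V × W)
_⊕_ G H = record
  { Adj = λ { (a , b) (c , d) → Adj G a c ⊎ Adj H b d }
  ; sym = λ { (Data.Sum.inj₁ g) → Data.Sum.inj₁ (sym G g) ; (Data.Sum.inj₂ h) → Data.Sum.inj₂ (sym H h) }
  ; irrefl = λ { (Data.Sum.inj₁ g) → irrefl G g ; (Data.Sum.inj₂ h) → irrefl H h }
  }

Independent : {V : Set} → Graph V → List V → Set
Independent G S = Unique S × (∀ u v → u ∈ S → v ∈ S → ¬ Adj G u v)

IsIndependenceNumber : {V : Set} → Graph V → ℕ → Set
IsIndependenceNumber G b =
  (Σ _ λ S → Independent G S × length S ≡ b) ×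
  (∀ S → Independent G S → length S ≤ b)

-- Distances in a strong product are the maxima of the coordinate distances,
-- d((a,b),(c,d)) = d(a,c) ⊔ d(b,d). Hence if a ~ c and b ~ d in the strong
-- resolving graphs (or one coordinate is fixed), every neighbour of (a,b) is
-- no farther from (c,d) than (a,b) itself: SR G ⊠ SR H is a subgraph of
-- SR (G ⊠ H). Conversely, if (a,b) and (c,d) are mutually maximally distant in
-- G ⊠ H, then the coordinate realising the maximum consists of mutually
-- maximally distant vertices, so SR (G ⊠ H) is a subgraph of SR G ⊕ SR H.
-- Adding edges can only decrease the independence number. Since walks are
-- not decidable, least walk lengths exist only under double negation; every
-- conclusion drawn from them is an inequality on ℕ or a negation, hence stable.
module Submission where

open import Defs
open import Data.Nat using (ℕ; zero; suc; _≤_; _<_; _⊔_; z≤n; s≤s; _≤?_)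
open import Data.Nat.Properties
open import Data.Nat.Induction using (<-rec)
open import Data.Product using (_×_; _,_; ∃; ∃₂; proj₁; proj₂)
open import Data.Sum using (_⊎_; inj₁; inj₂) renaming (map to ⊎-map)
open import Effect.Monad using (RawMonad)
open import Level using (0ℓ)
open import Relation.Nullary using (¬_)
open import Relation.Nullary.Decidable using (decidable-stable)
open import Relation.Nullary.Negation using (¬¬-Monad; contradiction)
open import Relation.Binary.PropositionalEquality
  using (_≡_; refl; cong; subst; module ≡-Reasoning)
  renaming (sym to ≡-sym)

open RawMonad (¬¬-Monad {0ℓ}) using (pure; _>>=_)

¬¬-least : ∀ {P : ℕ → Set} {n} → P n → ¬ ¬ ∃ λ k → P k × (∀ j → P j → k ≤ j)
¬¬-least {P} {n} pn noLeast = <-rec (λ n → ¬ P n) noneBelow n pn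
  where
  noneBelow : ∀ n → (∀ {m} → m < n → ¬ P m) → ¬ P n
  noneBelow n below pn = noLeast (n , pn , λ j pj → ≮⇒≥ λ j<n → below j<n pj)

≤-stable : ∀ {m n} → ¬ ¬ m ≤ n → m ≤ n
≤-stable = decidable-stable (_ ≤? _)

adj⇒≢ : ∀ {V} (G : Graph V) {u v} → Adj G u v → ¬ u ≡ v
adj⇒≢ G uv refl = irrefl G uv

module _ {V : Set} (G : Graph V) where

  snoc : ∀ {u v w k} → Walk G u v k → Adj G v w → Walk G u w (suc k)
  snoc here vw = step vw here
  snoc (step uu′ w) vw = step uu′ (snoc w vw)

  reverse : ∀ {u v k} → Walk G u v k → Walk G v u k
  reverse here = here
  reverse (step uw w) = snoc (reverse w) (sym G uw)

  Dist-sym : ∀ {u v k} → Dist G u v k → Dist G v u k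
  Dist-sym (w , least) = reverse w , λ j w′ → least j (reverse w′)

  Dist-unique : ∀ {u v k l} → Dist G u v k → Dist G u v l → k ≡ l
  Dist-unique (wk , leastk) (wl , leastl) = ≤-antisym (leastk _ wl) (leastl _ wk)

  Dist-0⇒≡ : ∀ {u v} → Dist G u v 0 → u ≡ v
  Dist-0⇒≡ (here , _) = refl

  Dist-self : ∀ {u k} → Dist G u u k → k ≡ 0
  Dist-self (_ , least) = n≤0⇒n≡0 (least 0 here)

  Dist-≢⇒1≤ : ∀ {u v k} → ¬ u ≡ v → Dist G u v k → 1 ≤ k
  Dist-≢⇒1≤ {k = zero}  u≢v d = contradiction (Dist-0⇒≡ d) u≢v
  Dist-≢⇒1≤ {k = suc _} _   _ = s≤s z≤n

  walk⇒¬¬Dist : ∀ {u v k} → Walk G u v k → ¬ ¬ ∃ (Dist G u v)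
  walk⇒¬¬Dist = ¬¬-least

  -- When x ~ a, either a = c and d(c,x) = 1, or a is maximally distant from c.
  Dist-closedNbr-≤ : ∀ {a c x α α′ B} → a ≡ c ⊎ Adj (SR G) a c → a ≡ x ⊎ Adj G a x →
                     Dist G a c α → Dist G c x α′ → α ≤ B → 1 ≤ B → α′ ≤ B
  Dist-closedNbr-≤ _ (inj₁ refl) dac dca α≤B _ =
    subst (_≤ _) (Dist-unique (Dist-sym dac) dca) α≤B
  Dist-closedNbr-≤ (inj₁ refl) (inj₂ ax) _ (_ , least) _ 1≤B =
    ≤-trans (least 1 (step ax here)) 1≤B
  Dist-closedNbr-≤ (inj₂ (_ , a-maxDist-c , _)) (inj₂ ax) dac dcx α≤B _ =
    ≤-trans (a-maxDist-c _ ax _ _ dcx dac) α≤B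

walk-contract : ∀ {V W} {G : Graph V} {H : Graph W} (f : V → W) →
                (∀ {u v} → Adj G u v → f u ≡ f v ⊎ Adj H (f u) (f v)) →
                ∀ {u v k} → Walk G u v k → ∃ λ j → j ≤ k × Walk H (f u) (f v) j
walk-contract f f-adj here = 0 , z≤n , here
walk-contract {H = H} f f-adj {v = v} (step uw w) with f-adj uw | walk-contract f f-adj w
... | inj₁ fu≡fw | j , j≤k , w′ = j , m≤n⇒m≤1+n j≤k , subst (λ x → Walk H x (f v) j) (≡-sym fu≡fw) w′
... | inj₂ fufw  | j , j≤k , w′ = suc j , s≤s j≤k , step fufw w′

module _ {V W : Set} {G : Graph V} {H : Graph W} where

  ⊠-adj⇒≡⊎adjˡ : ∀ {u v} → Adj (G ⊠ H) u v → proj₁ u ≡ proj₁ v ⊎ Adj G (proj₁ u) (proj₁ v)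
  ⊠-adj⇒≡⊎adjˡ (inj₁ (a≡c , _))        = inj₁ a≡c
  ⊠-adj⇒≡⊎adjˡ (inj₂ (inj₁ (ac , _)))  = inj₂ ac
  ⊠-adj⇒≡⊎adjˡ (inj₂ (inj₂ (ac , _)))  = inj₂ ac

  ⊠-adj⇒≡⊎adjʳ : ∀ {u v} → Adj (G ⊠ H) u v → proj₂ u ≡ proj₂ v ⊎ Adj H (proj₂ u) (proj₂ v)
  ⊠-adj⇒≡⊎adjʳ (inj₁ (_ , bd))         = inj₂ bd
  ⊠-adj⇒≡⊎adjʳ (inj₂ (inj₁ (_ , b≡d))) = inj₁ b≡d
  ⊠-adj⇒≡⊎adjʳ (inj₂ (inj₂ (_ , bd)))  = inj₂ bd

module _ {V W : Set} {G : Graph V} {H : Graph W} where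

  ⊠-walkˡ : ∀ {a b c p} → Walk G a c p → Walk (G ⊠ H) (a , b) (c , b) p
  ⊠-walkˡ here       = here
  ⊠-walkˡ (step g w) = step (inj₂ (inj₁ (g , refl))) (⊠-walkˡ w)

  ⊠-walkʳ : ∀ {a b d q} → Walk H b d q → Walk (G ⊠ H) (a , b) (a , d) q
  ⊠-walkʳ here       = here
  ⊠-walkʳ (step h w) = step (inj₁ (refl , h)) (⊠-walkʳ w)

  ⊠-walk : ∀ {a b c d p q} → Walk G a c p → Walk H b d q → Walk (G ⊠ H) (a , b) (c , d) (p ⊔ q)
  ⊠-walk here          w          = ⊠-walkʳ w
  ⊠-walk w@(step _ _)  here       = ⊠-walkˡ w
  ⊠-walk (step g w)    (step h v) = step (inj₂ (inj₂ (g , h))) (⊠-walk w v)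

  ⊠-projˡ : ∀ {a b c d k} → Walk (G ⊠ H) (a , b) (c , d) k → ∃ λ j → j ≤ k × Walk G a c j
  ⊠-projˡ = walk-contract proj₁ (⊠-adj⇒≡⊎adjˡ {G = G} {H = H})

  ⊠-projʳ : ∀ {a b c d k} → Walk (G ⊠ H) (a , b) (c , d) k → ∃ λ j → j ≤ k × Walk H b d j
  ⊠-projʳ = walk-contract proj₂ (⊠-adj⇒≡⊎adjʳ {G = G} {H = H})

  Dist-⊠ : ∀ {a b c d α γ} → Dist G a c α → Dist H b d γ → Dist (G ⊠ H) (a , b) (c , d) (α ⊔ γ)
  Dist-⊠ (wG , leastG) (wH , leastH) = ⊠-walk wG wH , λ j w → ⊔-lub (boundˡ w) (boundʳ w)
    where
    boundˡ : ∀ {j} → Walk (G ⊠ H) _ _ j → _ ≤ j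
    boundˡ w with ⊠-projˡ w
    ... | i , i≤j , w′ = ≤-trans (leastG i w′) i≤j
    boundʳ : ∀ {j} → Walk (G ⊠ H) _ _ j → _ ≤ j
    boundʳ w with ⊠-projʳ w
    ... | i , i≤j , w′ = ≤-trans (leastH i w′) i≤j

  Dist-⊠-split : ∀ {a b c d k} → Dist (G ⊠ H) (a , b) (c , d) k →
                 ¬ ¬ ∃₂ λ α γ → Dist G a c α × Dist H b d γ × k ≡ α ⊔ γ
  Dist-⊠-split d = do
    (α , dα) ← walk⇒¬¬Dist G (proj₂ (proj₂ (⊠-projˡ (proj₁ d))))
    (γ , dγ) ← walk⇒¬¬Dist H (proj₂ (proj₂ (⊠-projʳ (proj₁ d))))
    pure (α , γ , dα , dγ , Dist-unique (G ⊠ H) d (Dist-⊠ dα dγ))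

  SR⊠SR⇒maxDist : ∀ {u v} → Adj (SR G ⊠ SR H) u v → MaxDist (G ⊠ H) u v
  SR⊠SR⇒maxDist uv x ux A B dA dB = ≤-stable do
    (α , γ , dα , dγ , B≡α⊔γ) ← Dist-⊠-split dB
    (α′ , γ′ , dα′ , dγ′ , A≡α′⊔γ′) ← Dist-⊠-split dA
    let 1≤B = Dist-≢⇒1≤ (G ⊠ H) (adj⇒≢ (SR G ⊠ SR H) uv) dB
        B≡  = ≡-sym B≡α⊔γ
    pure (subst (_≤ B) (≡-sym A≡α′⊔γ′) (⊔-lub
      (Dist-closedNbr-≤ G (⊠-adj⇒≡⊎adjˡ {G = SR G} {H = SR H} uv) (⊠-adj⇒≡⊎adjˡ {G = G} {H = H} ux) dα dα′
        (subst (α ≤_) B≡ (m≤m⊔n α γ)) 1≤B)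
      (Dist-closedNbr-≤ H (⊠-adj⇒≡⊎adjʳ {G = SR G} {H = SR H} uv) (⊠-adj⇒≡⊎adjʳ {G = G} {H = H} ux) dγ dγ′
        (subst (γ ≤_) B≡ (m≤n⊔m α γ)) 1≤B)))

  SR⊠SR⊆SR⊠ : ∀ {u v} → Adj (SR G ⊠ SR H) u v → Adj (SR (G ⊠ H)) u v
  SR⊠SR⊆SR⊠ uv = adj⇒≢ (SR G ⊠ SR H) uv
               , SR⊠SR⇒maxDist uv , SR⊠SR⇒maxDist (sym (SR G ⊠ SR H) uv)

  ⊠-maxDist⇒maxDistˡ : ∀ {a b c d α γ} → MaxDist (G ⊠ H) (a , b) (c , d) →
                        Dist G a c α → Dist H b d γ → γ ≤ α → MaxDist G a c
  ⊠-maxDist⇒maxDistˡ {b = b} {α = α} {γ} md dα dγ γ≤α x ax α′ β dcx dac = begin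
    α′      ≤⟨ m≤m⊔n α′ γ ⟩
    α′ ⊔ γ  ≤⟨ md (x , b) (inj₂ (inj₁ (ax , refl))) _ _ (Dist-⊠ dcx (Dist-sym H dγ)) (Dist-⊠ dα dγ) ⟩
    α ⊔ γ   ≡⟨ m≥n⇒m⊔n≡m γ≤α ⟩
    α       ≡⟨ Dist-unique G dα dac ⟩
    β       ∎
    where open ≤-Reasoning

  ⊠-maxDist⇒maxDistʳ : ∀ {a b c d α γ} → MaxDist (G ⊠ H) (a , b) (c , d) →
                        Dist G a c α → Dist H b d γ → α ≤ γ → MaxDist H b d
  ⊠-maxDist⇒maxDistʳ {a = a} {α = α} {γ} md dα dγ α≤γ y by γ′ β ddy dbd = begin
    γ′      ≤⟨ m≤n⊔m α γ′ ⟩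
    α ⊔ γ′  ≤⟨ md (a , y) (inj₁ (refl , by)) _ _ (Dist-⊠ (Dist-sym G dα) ddy) (Dist-⊠ dα dγ) ⟩
    α ⊔ γ   ≡⟨ m≤n⇒m⊔n≡n α≤γ ⟩
    γ       ≡⟨ Dist-unique H dγ dbd ⟩
    β       ∎
    where open ≤-Reasoning

  SR⊠⇒SRˡ : ∀ {a b c d α γ} → Adj (SR (G ⊠ H)) (a , b) (c , d) →
             Dist G a c α → Dist H b d γ → γ ≤ α → Adj (SR G) a c
  SR⊠⇒SRˡ {a} {b} {c} {d} (u≢v , m₁ , m₂) dα dγ γ≤α =
    a≢c , ⊠-maxDist⇒maxDistˡ m₁ dα dγ γ≤α , ⊠-maxDist⇒maxDistˡ m₂ (Dist-sym G dα) (Dist-sym H dγ) γ≤α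
    where
    a≢c : ¬ a ≡ c
    a≢c refl = u≢v (cong (a ,_) (Dist-0⇒≡ H (subst (Dist H b d) γ≡0 dγ)))
      where γ≡0 = n≤0⇒n≡0 (subst (_ ≤_) (Dist-self G dα) γ≤α)

  SR⊠⇒SRʳ : ∀ {a b c d α γ} → Adj (SR (G ⊠ H)) (a , b) (c , d) →
             Dist G a c α → Dist H b d γ → α ≤ γ → Adj (SR H) b d
  SR⊠⇒SRʳ {a} {b} {c} {d} (u≢v , m₁ , m₂) dα dγ α≤γ =
    b≢d , ⊠-maxDist⇒maxDistʳ m₁ dα dγ α≤γ , ⊠-maxDist⇒maxDistʳ m₂ (Dist-sym G dα) (Dist-sym H dγ) α≤γ
    where
    b≢d : ¬ b ≡ d
    b≢d refl = u≢v (cong (_, b) (Dist-0⇒≡ G (subst (Dist G a c) α≡0 dα)))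
      where α≡0 = n≤0⇒n≡0 (subst (_ ≤_) (Dist-self H dγ) α≤γ)

  SR⊠⊆¬¬SR⊕ : Connected G → Connected H →
               ∀ {u v} → Adj (SR (G ⊠ H)) u v → ¬ ¬ Adj (SR G ⊕ SR H) u v
  SR⊠⊆¬¬SR⊕ conG conH {a , b} {c , d} uv = do
    (α , dα) ← walk⇒¬¬Dist G (proj₂ (conG a c))
    (γ , dγ) ← walk⇒¬¬Dist H (proj₂ (conH b d))
    pure (⊎-map (SR⊠⇒SRˡ uv dα dγ) (SR⊠⇒SRʳ uv dα dγ) (≤-total γ α))

module _ {V : Set} (G H : Graph V) (G⊆H : ∀ {u v} → Adj G u v → ¬ ¬ Adj H u v) where

  Independent-⊆ : ∀ {S} → Independent H S → Independent G S
  Independent-⊆ (unique , indep) = unique , λ u v u∈S v∈S uv → G⊆H uv (indep u v u∈S v∈S)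

  independenceNumber-antitone : ∀ {βG βH} → IsIndependenceNumber G βG → IsIndependenceNumber H βH → βH ≤ βG
  independenceNumber-antitone (_ , maxG) ((S , indS , |S|≡βH) , _) =
    subst (_≤ _) |S|≡βH (maxG S (Independent-⊆ indS))

corollary8 : ∀ {n m : ℕ} (G : FinGraph n) (H : FinGraph m) →
    Connected G → Connected H →
    ∀ (b₁ b₂ b₃ : ℕ) →
    IsIndependenceNumber (SR G ⊠ SR H) b₁ →
    IsIndependenceNumber (SR (G ⊠ H)) b₂ →
    IsIndependenceNumber (SR G ⊕ SR H) b₃ →
    b₂ ≤ b₁ × b₃ ≤ b₂
corollary8 G H conG conH _ _ _ β₁ β₂ β₃ =
  independenceNumber-antitone (SR G ⊠ SR H) (SR (G ⊠ H)) (λ uv → pure (SR⊠SR⊆SR⊠ uv)) β₁ β₂ ,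
  independenceNumber-antitone (SR (G ⊠ H)) (SR G ⊕ SR H) (SR⊠⊆¬¬SR⊕ conG conH) β₂ β₃
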